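{- $\lim_{n\to+\infty}M_n=\lim_{n\to+\infty}L_n=+\infty$.
   Context: For $n\ge 0$, $[n]=\{1,\dots,n\}$. A partition $\pi$ of $[n]$ is noncrossing if there are no two distinct blocks $A,B$ of $\pi$ and elements $a<b$ in $A$, $c<d$ in $B$ with $a<c<b<d$. A noncrossing partition $\pi$ of $[n]$ is a marriageable singles partition if it has two distinct singleton blocks $\{i\},\{j\}$ ($i\ne j$) such that the partition obtained by replacing these two blocks with the block $\{i,j\}$ is still noncrossing; otherwise it is a lonely singles partition. $M_n$ and $L_n$ denote the numbers of marriageable singles and lonely singles partitions of $[n]$, respectively. -}

module Defs where

open import Data.Bool using (Bool; true; false; _∧_; _∨_; not; if_then_else_)
open import Data.Nat using (ℕ; zero; suc; _≤_; _<ᵇ_; _≡ᵇ_)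
open import Data.Fin using (Fin; toℕ)
open import Data.Vec using (Vec; []; _∷_; lookup)
open import Data.List using (List; []; _∷_; map; concatMap; allFin; filterᵇ; length)
open import Data.Bool.ListAction using (all; any)
open import Data.Product using (∃-syntax)

-- A partition π of [n] = {1..n} is encoded (via its "same block" equivalence
-- relation) as an n×n Boolean matrix R, with R i j = true iff i, j lie in the
-- same block.  Elements of [n] are represented by Fin n (i ↦ i+1); the
-- order on Fin n agrees with the order on [n].
Rel : ℕ → Set
Rel n = Vec (Vec Bool n) n

rel : ∀ {n} → Rel n → Fin n → Fin n → Bool
rel R i j = lookup (lookup R i) j

∀ᵇ : ∀ n → (Fin n → Bool) → Bool
∀ᵇ n p = all p (allFin n)

∃ᵇ : ∀ n → (Fin n → Bool) → Bool
∃ᵇ n p = any p (allFin n)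

_⇒ᵇ_ : Bool → Bool → Bool
a ⇒ᵇ b = not a ∨ b

_<F_ : ∀ {n} → Fin n → Fin n → Bool
i <F j = toℕ i <ᵇ toℕ j

_=F_ : ∀ {n} → Fin n → Fin n → Bool
i =F j = toℕ i ≡ᵇ toℕ j

isEquiv : ∀ n → (Fin n → Fin n → Bool) → Bool
isEquiv n r =
  ∀ᵇ n (λ i → r i i) ∧
  ∀ᵇ n (λ i → ∀ᵇ n (λ j → r i j ⇒ᵇ r j i)) ∧
  ∀ᵇ n (λ i → ∀ᵇ n (λ j → ∀ᵇ n (λ k → (r i j ∧ r j k) ⇒ᵇ r i k)))

-- noncrossing: there are no a < c < b < d with a,b in one block, c,d in
-- another (distinct) block.  I.e. whenever a < c < b < d, a ~ b and c ~ d,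
-- then a ~ c.
isNC : ∀ n → (Fin n → Fin n → Bool) → Bool
isNC n r =
  ∀ᵇ n (λ a → ∀ᵇ n (λ c → ∀ᵇ n (λ b → ∀ᵇ n (λ d →
    (a <F c ∧ c <F b ∧ b <F d ∧ r a b ∧ r c d) ⇒ᵇ r a c))))

isSingleton : ∀ n → (Fin n → Fin n → Bool) → Fin n → Bool
isSingleton n r i = ∀ᵇ n (λ j → r i j ⇒ᵇ (i =F j))

merge : ∀ {n} → (Fin n → Fin n → Bool) → Fin n → Fin n → (Fin n → Fin n → Bool)
merge r i j x y =
  r x y ∨ ((r x i ∨ r x j) ∧ (r y i ∨ r y j))

isPartition : ∀ {n} → Rel n → Bool
isPartition {n} R = isEquiv n (rel R)

isNCPartition : ∀ {n} → Rel n → Bool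
isNCPartition {n} R = isPartition R ∧ isNC n (rel R)

isMarriageable : ∀ {n} → Rel n → Bool
isMarriageable {n} R = isNCPartition R ∧
  ∃ᵇ n (λ i → ∃ᵇ n (λ j →
    not (i =F j) ∧ isSingleton n (rel R) i ∧ isSingleton n (rel R) j ∧
    isNC n (merge (rel R) i j)))

isLonely : ∀ {n} → Rel n → Bool
isLonely R = isNCPartition R ∧ not (isMarriageable R)

allVecs : ∀ {A : Set} → List A → (n : ℕ) → List (Vec A n)
allVecs xs zero = [] ∷ []
allVecs xs (suc n) = concatMap (λ x → map (x ∷_) (allVecs xs n)) xs

-- all n×n Boolean matrices (each exactly once)
allRels : (n : ℕ) → List (Rel n)
allRels n = allVecs (allVecs (true ∷ false ∷ []) n) n

M : ℕ → ℕ
M n = length (filterᵇ isMarriageable (allRels n))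

L : ℕ → ℕ
L n = length (filterᵇ isLonely (allRels n))

TendsToInfinity : (ℕ → ℕ) → Set
TendsToInfinity f = ∀ K → ∃[ N ] (∀ n → N ≤ n → K ≤ f n)

{-# OPTIONS --safe #-}
-- Both counts are bounded below by explicit families of size about n.  A
-- monotone labelling of [n] induces a partition into intervals, which is
-- noncrossing.  Labelling by k ⊔ x gives the block {0,…,k} followed by
-- singletons; two adjacent singletons can always be merged, so these are
-- marriageable.  Labelling by 1 ⊓ (x ∸ k) gives the two blocks {0,…,k} and
-- {k+1,…,n-1}; without any singleton they are lonely.  In both families the
-- block of 0 determines k, so different k give different partitions.
module Submission where

open import Defs
open import Data.Bool using (Bool; true; false; T; T?; _∨_; not)
open import Data.Bool.Properties using (T-∧; T-∨)
open import Data.Empty using (⊥; ⊥-elim)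
open import Data.Fin using (Fin; toℕ; fromℕ<)
open import Data.Fin.Properties using (toℕ-injective; toℕ-fromℕ<; toℕ<n; injective⇒≤)
open import Data.List using (List; map; allFin; filterᵇ; length; lookup)
open import Data.List.Membership.Propositional using (_∈_)
open import Data.List.Membership.Propositional.Properties
  using (∈-map⁺; ∈-concatMap⁺; ∈-filter⁺; ∈-allFin)
open import Data.List.Relation.Unary.All as All using ()
open import Data.List.Relation.Unary.All.Properties using (all⁺; all⁻; tabulate⁺)
open import Data.List.Relation.Unary.Any as Any using (here; there)
open import Data.List.Relation.Unary.Any.Properties using (any⁺; any⁻; lookup-index)
open import Data.Nat
open import Data.Nat.Properties
open import Data.Product using (_×_; _,_; proj₁; proj₂; ∃-syntax)
open import Data.Sum using (inj₁; inj₂)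
open import Data.Vec using (Vec; []; _∷_; tabulate) renaming (lookup to lookupᵛ)
open import Data.Vec.Properties using (lookup∘tabulate)
open import Function using (_∘_; Injective)
open import Function.Bundles using (Equivalence)
open import Relation.Binary.Core using (_Preserves_⟶_)
open import Relation.Binary.Definitions using (tri<; tri≈; tri>)
open import Relation.Binary.PropositionalEquality
open import Relation.Nullary using (¬_; yes; no)

open Equivalence using (to; from)

⇒ᵇ-intro : ∀ {a b} → (T a → T b) → T (a ⇒ᵇ b)
⇒ᵇ-intro {false} _ = _
⇒ᵇ-intro {true}  f = f _

⇒ᵇ-elim : ∀ {a b} → T (a ⇒ᵇ b) → T a → T b
⇒ᵇ-elim {true} t _ = t

T-not⁺ : ∀ {a} → ¬ T a → T (not a)
T-not⁺ {false} _  = _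
T-not⁺ {true}  ¬t = ¬t _

module _ {n : ℕ} {p : Fin n → Bool} where

  ∀ᵇ-intro : (∀ i → T (p i)) → T (∀ᵇ n p)
  ∀ᵇ-intro h = all⁻ p (tabulate⁺ h)

  ∀ᵇ-elim : T (∀ᵇ n p) → ∀ i → T (p i)
  ∀ᵇ-elim t i = All.lookup (all⁺ p (allFin n) t) (∈-allFin i)

  ∃ᵇ-intro : ∀ i → T (p i) → T (∃ᵇ n p)
  ∃ᵇ-intro i t = any⁺ p (Any.map (λ { refl → t }) (∈-allFin i))

  ∃ᵇ-elim : T (∃ᵇ n p) → ∃[ i ] T (p i)
  ∃ᵇ-elim t = Any.satisfied (any⁻ p (allFin n) t)

NonCrossing : ∀ {n} → (Fin n → Fin n → Bool) → Set
NonCrossing r = ∀ {a c b d} → toℕ a < toℕ c → toℕ c < toℕ b → toℕ b < toℕ d →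
                T (r a b) → T (r c d) → T (r a c)

module _ {n : ℕ} {r : Fin n → Fin n → Bool} where

  isNC-intro : NonCrossing r → T (isNC n r)
  isNC-intro nc =
    ∀ᵇ-intro {n} λ a → ∀ᵇ-intro {n} λ c → ∀ᵇ-intro {n} λ b → ∀ᵇ-intro {n} λ d → ⇒ᵇ-intro λ h →
      let a<c , h₁   = to (T-∧ {a <F c}) h
          c<b , h₂   = to (T-∧ {c <F b}) h₁
          b<d , h₃   = to (T-∧ {b <F d}) h₂
          rab , rcd  = to (T-∧ {r a b}) h₃
      in nc (<ᵇ⇒< _ _ a<c) (<ᵇ⇒< _ _ c<b) (<ᵇ⇒< _ _ b<d) rab rcd

  isEquiv-intro : (∀ i → T (r i i)) →
                  (∀ {i j} → T (r i j) → T (r j i)) →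
                  (∀ {i j k} → T (r i j) → T (r j k) → T (r i k)) →
                  T (isEquiv n r)
  isEquiv-intro refl′ sym′ trans′ = from T-∧
    ( ∀ᵇ-intro {n} refl′
    , from T-∧
        ( (∀ᵇ-intro {n} λ i → ∀ᵇ-intro {n} λ j → ⇒ᵇ-intro sym′)
        , (∀ᵇ-intro {n} λ i → ∀ᵇ-intro {n} λ j → ∀ᵇ-intro {n} λ k → ⇒ᵇ-intro λ h →
             let rij , rjk = to (T-∧ {r i j}) h in trans′ rij rjk)))

  isSingleton-intro : ∀ {i} → (∀ j → T (r i j) → i ≡ j) → T (isSingleton n r i)
  isSingleton-intro h = ∀ᵇ-intro {n} λ j → ⇒ᵇ-intro λ t → ≡⇒≡ᵇ _ _ (cong toℕ (h j t))

  isSingleton-elim : ∀ {i j} → T (isSingleton n r i) → T (r i j) → i ≡ j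
  isSingleton-elim {j = j} s t = toℕ-injective (≡ᵇ⇒≡ _ _ (⇒ᵇ-elim (∀ᵇ-elim {n} s j) t))

isMarriageable-intro : ∀ {n} {R : Rel n} {i j} → T (isNCPartition R) → i ≢ j →
                       T (isSingleton n (rel R) i) → T (isSingleton n (rel R) j) →
                       T (isNC n (merge (rel R) i j)) → T (isMarriageable R)
isMarriageable-intro {n} {i = i} {j} ncp i≢j sᵢ sⱼ nc = from T-∧
  (ncp , ∃ᵇ-intro {n} i (∃ᵇ-intro {n} j
    (from T-∧ (T-not⁺ (i≢j ∘ toℕ-injective ∘ ≡ᵇ⇒≡ _ _) , from T-∧ (sᵢ , from T-∧ (sⱼ , nc))))))

isLonely-intro : ∀ {n} {R : Rel n} → T (isNCPartition R) →
                 (∀ i → ¬ T (isSingleton n (rel R) i)) → T (isLonely R)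
isLonely-intro {n} {R} ncp noSingleton = from T-∧ (ncp , T-not⁺ λ m →
  let i , mᵢ  = ∃ᵇ-elim {n} (proj₂ (to (T-∧ {isNCPartition R}) m))
      j , mᵢⱼ = ∃ᵇ-elim {n} mᵢ
  in noSingleton i (proj₁ (to T-∧ (proj₂ (to (T-∧ {not (i =F j)}) mᵢⱼ)))))

nothing-strictly-between-adjacent : ∀ {m x y z} → m ≤ x → z ≤ suc m → x < y → y < z → ⊥
nothing-strictly-between-adjacent m≤x z≤1+m x<y y<z =
  1+n≰n (≤-trans (≤-trans (s≤s (s≤s m≤x)) (≤-trans (s≤s x<y) y<z)) z≤1+m)

module _ {n} {r : Fin n → Fin n → Bool} {i j : Fin n} (j≡1+i : toℕ j ≡ suc (toℕ i))
         (onlyᵢ : ∀ {x} → T (r x i) → x ≡ i) (onlyⱼ : ∀ {x} → T (r x j) → x ≡ j) where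

  merged-within-window : ∀ {x} → T (r x i ∨ r x j) → toℕ i ≤ toℕ x × toℕ x ≤ suc (toℕ i)
  merged-within-window {x} t with to (T-∨ {r x i}) t
  ... | inj₁ rxi rewrite onlyᵢ rxi = ≤-refl , n≤1+n _
  ... | inj₂ rxj rewrite onlyⱼ rxj = ≤-trans (n≤1+n _) (≤-reflexive (sym j≡1+i)) , ≤-reflexive j≡1+i

  nothing-strictly-between-merged : ∀ x {y : Fin n} z → T (r x i ∨ r x j) → T (r z i ∨ r z j) →
                                    toℕ x < toℕ y → toℕ y < toℕ z → ⊥
  nothing-strictly-between-merged x z x∈ z∈ =
    nothing-strictly-between-adjacent (proj₁ (merged-within-window {x} x∈))
                                      (proj₂ (merged-within-window {z} z∈))

  merge-adjacent-singletons-nonCrossing : NonCrossing r → NonCrossing (merge r i j)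
  merge-adjacent-singletons-nonCrossing nc {a} {c} {b} {d} a<c c<b b<d mab mcd
    with to (T-∨ {r a b}) mab | to (T-∨ {r c d}) mcd
  ... | inj₁ rab | inj₁ rcd = from T-∨ (inj₁ (nc a<c c<b b<d rab rcd))
  ... | inj₁ _   | inj₂ cd  =
    let c∈ , d∈ = to (T-∧ {r c i ∨ r c j}) cd in ⊥-elim (nothing-strictly-between-merged c d c∈ d∈ c<b b<d)
  ... | inj₂ ab  | _        =
    let a∈ , b∈ = to (T-∧ {r a i ∨ r a j}) ab in ⊥-elim (nothing-strictly-between-merged a b a∈ b∈ a<c c<b)

labelled : ∀ {n} → (ℕ → ℕ) → Rel n
labelled ℓ = tabulate λ i → tabulate λ j → ℓ (toℕ i) ≡ᵇ ℓ (toℕ j)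

UniqueLabel : (ℕ → ℕ) → ℕ → Set
UniqueLabel ℓ x = ∀ y → ℓ y ≡ ℓ x → y ≡ x

module _ {n : ℕ} (ℓ : ℕ → ℕ) where

  private
    r : Fin n → Fin n → Bool
    r = rel (labelled ℓ)

  rel-labelled : ∀ i j → r i j ≡ (ℓ (toℕ i) ≡ᵇ ℓ (toℕ j))
  rel-labelled i j = begin
    lookupᵛ (lookupᵛ (labelled ℓ) i) j              ≡⟨ cong (λ row → lookupᵛ row j) (lookup∘tabulate _ i) ⟩
    lookupᵛ (tabulate λ j → ℓ (toℕ i) ≡ᵇ ℓ (toℕ j)) j ≡⟨ lookup∘tabulate _ j ⟩
    ℓ (toℕ i) ≡ᵇ ℓ (toℕ j)                          ∎
    where open ≡-Reasoning

  labelled⁺ : ∀ {i j} → ℓ (toℕ i) ≡ ℓ (toℕ j) → T (r i j)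
  labelled⁺ {i} {j} e = subst T (sym (rel-labelled i j)) (≡⇒≡ᵇ _ _ e)

  labelled⁻ : ∀ {i j} → T (r i j) → ℓ (toℕ i) ≡ ℓ (toℕ j)
  labelled⁻ {i} {j} t = ≡ᵇ⇒≡ _ _ (subst T (rel-labelled i j) t)

  labelled-nonCrossing : ℓ Preserves _≤_ ⟶ _≤_ → NonCrossing r
  labelled-nonCrossing mono a<c c<b _ rab _ = labelled⁺ (≤-antisym
    (mono (<⇒≤ a<c))
    (≤-trans (mono (<⇒≤ c<b)) (≤-reflexive (sym (labelled⁻ rab)))))

  labelled-isNCPartition : ℓ Preserves _≤_ ⟶ _≤_ → T (isNCPartition (labelled {n} ℓ))
  labelled-isNCPartition mono = from T-∧
    ( isEquiv-intro {r = r} (λ _ → labelled⁺ refl)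
                    (λ rij → labelled⁺ (sym (labelled⁻ rij)))
                    (λ rij rjk → labelled⁺ (trans (labelled⁻ rij) (labelled⁻ rjk)))
    , isNC-intro (labelled-nonCrossing mono))

  labelled-only-member : ∀ {i x} → UniqueLabel ℓ (toℕ i) → T (r x i) → x ≡ i
  labelled-only-member {i} {x} u rxi = toℕ-injective (u (toℕ x) (labelled⁻ rxi))

  labelled-isSingleton : ∀ {i} → UniqueLabel ℓ (toℕ i) → T (isSingleton n r i)
  labelled-isSingleton u = isSingleton-intro {r = r} λ j rij →
    sym (labelled-only-member u (labelled⁺ (sym (labelled⁻ rij))))

  labelled-¬isSingleton : ∀ {x y} {i : Fin n} → x < y → y < n →
                          ℓ x ≡ ℓ (toℕ i) → ℓ y ≡ ℓ (toℕ i) → ¬ T (isSingleton n r i)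
  labelled-¬isSingleton {x} {y} {i} x<y y<n ℓx ℓy s = <-irrefl x≡y x<y
    where
      member : ∀ {z} (z<n : z < n) → ℓ z ≡ ℓ (toℕ i) → i ≡ fromℕ< z<n
      member z<n ℓz = isSingleton-elim {r = r} s
        (labelled⁺ (trans (sym ℓz) (cong ℓ (sym (toℕ-fromℕ< z<n)))))

      x<n : x < n
      x<n = <-trans x<y y<n

      x≡y : x ≡ y
      x≡y = begin
        x                  ≡⟨ toℕ-fromℕ< x<n ⟨
        toℕ (fromℕ< x<n)   ≡⟨ cong toℕ (trans (sym (member x<n ℓx)) (member y<n ℓy)) ⟩
        toℕ (fromℕ< y<n)   ≡⟨ toℕ-fromℕ< y<n ⟩
        y                  ∎
        where open ≡-Reasoning

  labelled-isMarriageable : ∀ {x} → ℓ Preserves _≤_ ⟶ _≤_ → suc x < n →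
                            UniqueLabel ℓ x → UniqueLabel ℓ (suc x) →
                            T (isMarriageable (labelled {n} ℓ))
  labelled-isMarriageable {x} mono 1+x<n uₓ u₁₊ₓ = isMarriageable-intro {R = labelled ℓ}
    (labelled-isNCPartition mono)
    (λ e → 1+n≢n (sym (trans (sym toℕ-i) (trans (cong toℕ e) toℕ-j))))
    (labelled-isSingleton uᵢ)
    (labelled-isSingleton uⱼ)
    (isNC-intro (merge-adjacent-singletons-nonCrossing {r = r} (trans toℕ-j (cong suc (sym toℕ-i)))
      (labelled-only-member uᵢ) (labelled-only-member uⱼ) (labelled-nonCrossing mono)))
    where
      i j : Fin n
      i = fromℕ< (<-trans (n<1+n x) 1+x<n)
      j = fromℕ< 1+x<n

      toℕ-i : toℕ i ≡ x
      toℕ-i = toℕ-fromℕ< (<-trans (n<1+n x) 1+x<n)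

      toℕ-j : toℕ j ≡ suc x
      toℕ-j = toℕ-fromℕ< 1+x<n

      uᵢ : UniqueLabel ℓ (toℕ i)
      uᵢ = subst (UniqueLabel ℓ) (sym toℕ-i) uₓ

      uⱼ : UniqueLabel ℓ (toℕ j)
      uⱼ = subst (UniqueLabel ℓ) (sym toℕ-j) u₁₊ₓ

marriedLabel : ℕ → ℕ → ℕ
marriedLabel k x = k ⊔ x

marriedLabel-unique : ∀ {k x} → k < x → UniqueLabel (marriedLabel k) x
marriedLabel-unique {k} {x} k<x y k⊔y≡k⊔x with ⊔-sel k y | trans k⊔y≡k⊔x (m≤n⇒m⊔n≡n (<⇒≤ k<x))
... | inj₁ k⊔y≡k | k⊔y≡x = ⊥-elim (<-irrefl (trans (sym k⊔y≡k) k⊔y≡x) k<x)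
... | inj₂ k⊔y≡y | k⊔y≡x = trans (sym k⊔y≡y) k⊔y≡x

marriedLabel-isMarriageable : ∀ {n k} → 2 + k < n → T (isMarriageable (labelled {n} (marriedLabel k)))
marriedLabel-isMarriageable {k = k} 2+k<n = labelled-isMarriageable (marriedLabel k) (⊔-monoʳ-≤ k) 2+k<n
  (marriedLabel-unique (n<1+n k)) (marriedLabel-unique (m<n⇒m<1+n (n<1+n k)))

lonelyLabel : ℕ → ℕ → ℕ
lonelyLabel k x = 1 ⊓ (x ∸ k)

lonelyLabel-≤ : ∀ {k x} → x ≤ k → lonelyLabel k x ≡ 0
lonelyLabel-≤ x≤k = cong (1 ⊓_) (m≤n⇒m∸n≡0 x≤k)

lonelyLabel-> : ∀ {k x} → k < x → lonelyLabel k x ≡ 1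
lonelyLabel-> k<x = m≤n⇒m⊓n≡m (m<n⇒0<n∸m k<x)

lonelyLabel-isLonely : ∀ {n k} → 1 ≤ k → 2 + k < n → T (isLonely (labelled {n} (lonelyLabel k)))
lonelyLabel-isLonely {n} {k} 1≤k 2+k<n =
  isLonely-intro {R = labelled ℓ} (labelled-isNCPartition {n} ℓ (⊓-monoʳ-≤ 1 ∘ ∸-monoˡ-≤ k)) noSingleton
  where
    ℓ : ℕ → ℕ
    ℓ = lonelyLabel k

    1<n : 1 < n
    1<n = ≤-trans (s≤s 1≤k) (≤-trans (n≤1+n (suc k)) (<⇒≤ 2+k<n))

    noSingleton : ∀ i → ¬ T (isSingleton n (rel (labelled ℓ)) i)
    noSingleton i with toℕ i ≤? k
    ... | yes i≤k = labelled-¬isSingleton ℓ (n<1+n 0) 1<n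
      (trans (lonelyLabel-≤ {k} z≤n) (sym (lonelyLabel-≤ i≤k)))
      (trans (lonelyLabel-≤ {k} {1} 1≤k) (sym (lonelyLabel-≤ i≤k)))
    ... | no i≰k = labelled-¬isSingleton ℓ (n<1+n (suc k)) 2+k<n
      (trans (lonelyLabel-> (n<1+n k)) (sym (lonelyLabel-> (≰⇒> i≰k))))
      (trans (lonelyLabel-> (m<n⇒m<1+n (n<1+n k))) (sym (lonelyLabel-> (≰⇒> i≰k))))

BlockOfZeroEndsAtParameter : (ℕ → ℕ → ℕ) → Set
BlockOfZeroEndsAtParameter ℓ = ∀ k → (∀ {j} → j ≤ k → ℓ k j ≡ ℓ k 0) × ℓ k (suc k) ≢ ℓ k 0

marriedLabel-blockOfZero : BlockOfZeroEndsAtParameter marriedLabel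
marriedLabel-blockOfZero k =
  (λ j≤k → trans (m≥n⇒m⊔n≡m j≤k) (sym (⊔-identityʳ k))) ,
  (λ e → 1+n≢n (trans (sym (m≤n⇒m⊔n≡n (n≤1+n k))) (trans e (⊔-identityʳ k))))

lonelyLabel-blockOfZero : BlockOfZeroEndsAtParameter lonelyLabel
lonelyLabel-blockOfZero k =
  (λ j≤k → trans (lonelyLabel-≤ j≤k) (sym (lonelyLabel-≤ {k} z≤n))) ,
  (λ e → 0≢1+n (trans (sym (lonelyLabel-≤ {k} z≤n)) (trans (sym e) (lonelyLabel-> (n<1+n k)))))

module _ {n : ℕ} (ℓ : ℕ → ℕ → ℕ) (blockOfZero : BlockOfZeroEndsAtParameter ℓ) where

  labelled-separated : ∀ {k k′} → k < k′ → suc k < n → labelled {n} (ℓ k) ≢ labelled (ℓ k′)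
  labelled-separated {k} {k′} k<k′ 1+k<n e = proj₂ (blockOfZero k) (begin
    ℓ k (suc k)   ≡⟨ cong (ℓ k) (toℕ-fromℕ< 1+k<n) ⟨
    ℓ k (toℕ j)   ≡⟨ labelled⁻ (ℓ k) (subst (λ R → T (rel R j z)) (sym e) (labelled⁺ (ℓ k′) sameBlock′)) ⟩
    ℓ k (toℕ z)   ≡⟨ cong (ℓ k) (toℕ-fromℕ< 0<n) ⟩
    ℓ k 0         ∎)
    where
      open ≡-Reasoning

      0<n : 0 < n
      0<n = <-trans z<s 1+k<n

      j z : Fin n
      j = fromℕ< 1+k<n
      z = fromℕ< 0<n

      sameBlock′ : ℓ k′ (toℕ j) ≡ ℓ k′ (toℕ z)
      sameBlock′ = begin
        ℓ k′ (toℕ j)   ≡⟨ cong (ℓ k′) (toℕ-fromℕ< 1+k<n) ⟩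
        ℓ k′ (suc k)   ≡⟨ proj₁ (blockOfZero k′) k<k′ ⟩
        ℓ k′ 0         ≡⟨ cong (ℓ k′) (toℕ-fromℕ< 0<n) ⟨
        ℓ k′ (toℕ z)   ∎

  labelled-injective : ∀ {k k′} → suc k < n → suc k′ < n → labelled {n} (ℓ k) ≡ labelled (ℓ k′) → k ≡ k′
  labelled-injective {k} {k′} 1+k<n 1+k′<n e with <-cmp k k′
  ... | tri< k<k′ _ _ = ⊥-elim (labelled-separated k<k′ 1+k<n e)
  ... | tri≈ _ k≡k′ _ = k≡k′
  ... | tri> _ _ k′<k = ⊥-elim (labelled-separated k′<k 1+k′<n (sym e))

injection-into-list⇒≤length : ∀ {A : Set} {K} {xs : List A} (f : Fin K → A) →
                              Injective _≡_ _≡_ f → (∀ t → f t ∈ xs) → K ≤ length xs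
injection-into-list⇒≤length {xs = xs} f f-injective f∈xs =
  injective⇒≤ {f = Any.index ∘ f∈xs} λ {t} {t′} e → f-injective (begin
    f t                              ≡⟨ lookup-index (f∈xs t) ⟩
    lookup xs (Any.index (f∈xs t))   ≡⟨ cong (lookup xs) e ⟩
    lookup xs (Any.index (f∈xs t′))  ≡⟨ lookup-index (f∈xs t′) ⟨
    f t′                             ∎)
  where open ≡-Reasoning

∈-allVecs : ∀ {A : Set} {xs : List A} → (∀ x → x ∈ xs) → ∀ {m} (v : Vec A m) → v ∈ allVecs xs m
∈-allVecs complete []      = here refl
∈-allVecs {xs = xs} complete {suc m} (x ∷ v) =
  ∈-concatMap⁺ (λ y → map (y ∷_) (allVecs xs m))
    (Any.map (λ { refl → ∈-map⁺ (x ∷_) (∈-allVecs complete v) }) (complete x))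

∈-allRels : ∀ {n} (R : Rel n) → R ∈ allRels n
∈-allRels = ∈-allVecs (∈-allVecs λ { true → here refl ; false → there (here refl) })

tendsToInfinity-labelled : (p : ∀ {n} → Rel n → Bool) (ℓ : ℕ → ℕ → ℕ) →
                           BlockOfZeroEndsAtParameter ℓ →
                           (∀ {n k} → 1 ≤ k → 2 + k < n → T (p (labelled {n} (ℓ k)))) →
                           TendsToInfinity (λ n → length (filterᵇ p (allRels n)))
tendsToInfinity-labelled p ℓ blockOfZero family K = 3 + K , λ n 3+K≤n →
  let 2+k<n : (t : Fin K) → 2 + suc (toℕ t) < n
      2+k<n t = ≤-trans (s≤s (s≤s (s≤s (toℕ<n t)))) 3+K≤n
  in injection-into-list⇒≤length (λ t → labelled {n} (ℓ (suc (toℕ t))))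
       (λ {t} {t′} e → toℕ-injective (suc-injective
          (labelled-injective ℓ blockOfZero (<⇒≤ (2+k<n t)) (<⇒≤ (2+k<n t′)) e)))
       (λ t → ∈-filter⁺ (T? ∘ p) (∈-allRels _) (family (s≤s z≤n) (2+k<n t)))

corollary21 : TendsToInfinity M × TendsToInfinity L
corollary21 =
  tendsToInfinity-labelled isMarriageable marriedLabel marriedLabel-blockOfZero
    (λ _ → marriedLabel-isMarriageable) ,
  tendsToInfinity-labelled isLonely lonelyLabel lonelyLabel-blockOfZero lonelyLabel-isLonely
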